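{- The maximum size of a set of mutually orthogoval affine planes of order $3$ (each isomorphic to $\mathrm{AG}(2,3)$), all on a common point set, is seven.
   Context: Two planes, both projective or both affine, of the same order and on the same point set are called orthogoval if every line of one plane intersects every line of the other plane in at most two points. A set of planes is a set of mutually orthogoval planes if the planes are pairwise orthogoval. -}

module Defs where

open import Data.Nat using (ℕ; _≤_)
open import Data.Fin using (Fin)
open import Data.Fin.Subset using (Subset; _∈_; _∉_; _∩_; ∣_∣; ⊥)
open import Data.List using (List)
import Data.List.Membership.Propositional as LM
open import Data.Product using (Σ; ∃; _×_; _,_)
open import Relation.Binary.PropositionalEquality using (_≡_; _≢_)
open import Relation.Nullary using (¬_)

-- Common point set of nine points (an affine plane of order 3 has 3² = 9 points).
Point : Set
Point = Fin 9

-- A line is a set of points; a plane (incidence structure on Point) is given by its set of lines,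
-- represented as a list (duplicates are harmless: the line set is list membership).
Line : Set
Line = Subset 9

Plane : Set
Plane = List Line

_isLineOf_ : Line → Plane → Set
l isLineOf P = l LM.∈ P

ExactlyOneLine : Plane → (Line → Set) → Set
ExactlyOneLine P Q = Σ Line λ l → (l isLineOf P) × Q l × (∀ m → m isLineOf P → Q m → m ≡ l)

Collinear : Plane → Point → Point → Point → Set
Collinear P x y z = Σ Line λ l → (l isLineOf P) × (x ∈ l) × (y ∈ l) × (z ∈ l)

record IsAffinePlane (P : Plane) : Set where
  field
    joining  : ∀ (x y : Point) → x ≢ y → ExactlyOneLine P (λ l → (x ∈ l) × (y ∈ l))
    parallel : ∀ (l : Line) → l isLineOf P → ∀ (p : Point) → p ∉ l →
               ExactlyOneLine P (λ m → (p ∈ m) × (m ∩ l ≡ ⊥))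
    nondegenerate : Σ Point λ x → Σ Point λ y → Σ Point λ z → ¬ Collinear P x y z

record IsAffinePlaneOfOrder3 (P : Plane) : Set where
  field
    isAffinePlane : IsAffinePlane P
    lineSize      : ∀ l → l isLineOf P → ∣ l ∣ ≡ 3

Orthogoval : Plane → Plane → Set
Orthogoval P Q = ∀ l m → l isLineOf P → m isLineOf Q → ∣ l ∩ m ∣ ≤ 2

-- A set of k mutually orthogoval affine planes of order 3 on the common point set Point,
-- indexed by Fin k (pairwise orthogovality forces the planes to be distinct, since a plane
-- is never orthogoval to itself).
MutuallyOrthogovalAffine3 : (k : ℕ) → (Fin k → Plane) → Set
MutuallyOrthogovalAffine3 k F =
  (∀ i → IsAffinePlaneOfOrder3 (F i)) × (∀ i j → i ≢ j → Orthogoval (F i) (F j))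

HasMOAP3 : ℕ → Set
HasMOAP3 k = Σ (Fin k → Plane) (MutuallyOrthogovalAffine3 k)

-- In any affine plane of order 3 on the points 0, …, 8 the line through 0 and 1 has a
-- third point, one of the seven points 2, …, 8.  Two orthogoval planes cannot agree on
-- it, for then their lines through 0 and 1 would share three points; by the pigeonhole
-- principle there are at most seven mutually orthogoval planes.  Conversely, seven such
-- planes are exhibited and checked by decision procedures for the axioms.
module Submission where

open import Defs
open import Data.Nat using (ℕ; _≤_)
open import Data.Product using (_×_)

open import Data.Nat using (suc; _+_; _<_; _≤?_; _<?_; z≤n; s≤s) renaming (_≟_ to _≟ℕ_)
open import Data.Nat.Properties using (≤-refl; ≤-reflexive; ≤-trans; n≤1+n; <⇒≱; ≮⇒≥; +-cancelˡ-<)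
open import Data.Fin using (Fin; zero; suc; #_; _↑ʳ_; _≟_)
open import Data.Fin.Properties using (pigeonhole; <⇒≢) renaming (all? to allFin?; any? to anyFin?)
open import Data.Fin.Subset using (Subset; inside; outside; _∈_; _∩_; _∪_; ⁅_⁆; ∣_∣; ⊥; Nonempty)
open import Data.Fin.Subset.Properties using (_∈?_; x∈p∩q⁺)
open import Data.Bool.Properties using () renaming (_≟_ to _≟𝔹_)
open import Data.Vec using (Vec; []; _∷_; here; there; lookup)
open import Data.Vec.Properties using (≡-dec)
open import Data.List using ([]; _∷_)
open import Data.List.Membership.Propositional using (find; lose)
open import Data.List.Relation.Unary.All as All using (All)
open import Data.List.Relation.Unary.Any using (Any; any?)
open import Data.Product using (∃; _,_; proj₁; proj₂; map; map₂)
open import Relation.Nullary using (¬_; Dec; ¬?; _×-dec_; _→-dec_)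
open import Relation.Nullary.Decidable using (True; map′; from-yes)
open import Relation.Binary.PropositionalEquality using (_≡_; sym; subst)

x∈p⇒0<∣p∣ : ∀ {n} {x : Fin n} {p : Subset n} → x ∈ p → 0 < ∣ p ∣
x∈p⇒0<∣p∣ {p = inside  ∷ _} _           = s≤s z≤n
x∈p⇒0<∣p∣ {p = outside ∷ _} (there x∈p) = x∈p⇒0<∣p∣ x∈p

0<∣p∣⇒Nonempty : ∀ {n} (p : Subset n) → 0 < ∣ p ∣ → Nonempty p
0<∣p∣⇒Nonempty (inside  ∷ _) _      = zero , here
0<∣p∣⇒Nonempty (outside ∷ p) 0<∣p∣ = map suc there (0<∣p∣⇒Nonempty p 0<∣p∣)

∣x∷p∣≤1+∣p∣ : ∀ {n} x (p : Subset n) → ∣ x ∷ p ∣ ≤ suc ∣ p ∣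
∣x∷p∣≤1+∣p∣ inside  p = ≤-refl
∣x∷p∣≤1+∣p∣ outside p = n≤1+n ∣ p ∣

2<∣p∣⇒∃∈-beyond-2 : ∀ {n} (p : Subset (2 + n)) → 2 < ∣ p ∣ → ∃ λ c → 2 ↑ʳ c ∈ p
2<∣p∣⇒∃∈-beyond-2 (x ∷ y ∷ r) 2<∣p∣ = map₂ (λ c∈r → there (there c∈r)) (0<∣p∣⇒Nonempty r 0<∣r∣)
  where
  0<∣r∣ : 0 < ∣ r ∣
  0<∣r∣ = +-cancelˡ-< 2 0 ∣ r ∣
    (≤-trans 2<∣p∣ (≤-trans (∣x∷p∣≤1+∣p∣ x (y ∷ r)) (s≤s (∣x∷p∣≤1+∣p∣ y r))))

0,1,2↑ʳc∈p⇒2<∣p∣ : ∀ {n} {p : Subset (2 + n)} {c} → zero ∈ p → suc zero ∈ p → 2 ↑ʳ c ∈ p → 2 < ∣ p ∣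
0,1,2↑ʳc∈p⇒2<∣p∣ here (there here) (there (there c∈r)) = s≤s (s≤s (x∈p⇒0<∣p∣ c∈r))

CollinearWith01 : Plane → Fin 7 → Set
CollinearWith01 P c = Collinear P zero (suc zero) (2 ↑ʳ c)

orthogoval⇒¬bothCollinearWith01 : ∀ {P Q} c → Orthogoval P Q →
                                  CollinearWith01 P c → ¬ CollinearWith01 Q c
orthogoval⇒¬bothCollinearWith01 c orth (l , l∈P , 0∈l , 1∈l , c∈l) (m , m∈Q , 0∈m , 1∈m , c∈m) =
  <⇒≱ (0,1,2↑ʳc∈p⇒2<∣p∣ (x∈p∩q⁺ (0∈l , 0∈m)) (x∈p∩q⁺ (1∈l , 1∈m)) (x∈p∩q⁺ (c∈l , c∈m)))
      (orth l m l∈P m∈Q)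

thirdPointOn01 : ∀ {P} → IsAffinePlaneOfOrder3 P → ∃ (CollinearWith01 P)
thirdPointOn01 A with IsAffinePlane.joining (IsAffinePlaneOfOrder3.isAffinePlane A) zero (suc zero) (λ ())
... | l , l∈P , (0∈l , 1∈l) , _ with 2<∣p∣⇒∃∈-beyond-2 l (≤-reflexive (sym (IsAffinePlaneOfOrder3.lineSize A l l∈P)))
...   | c , c∈l = c , l , l∈P , 0∈l , 1∈l , c∈l

moap3≤7 : ∀ k → HasMOAP3 k → k ≤ 7
moap3≤7 k (F , affine , orthogoval) = ≮⇒≥ λ 7<k →
  let third : Fin k → Fin 7
      third i = proj₁ (thirdPointOn01 (affine i))
      i , j , i<j , same = pigeonhole 7<k third
  in orthogoval⇒¬bothCollinearWith01 (third i) (orthogoval i j (<⇒≢ i<j))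
       (proj₂ (thirdPointOn01 (affine i)))
       (subst (CollinearWith01 (F j)) (sym same) (proj₂ (thirdPointOn01 (affine j))))

infix 4 _≟ₗ_
_≟ₗ_ : (l m : Line) → Dec (l ≡ m)
_≟ₗ_ = ≡-dec _≟𝔹_

allLines? : ∀ P {R : Line → Set} → (∀ l → Dec (R l)) → Dec (∀ l → l isLineOf P → R l)
allLines? P R? = map′ (λ all l → All.lookup all) (λ f → All.tabulate (f _)) (All.all? R? P)

exactlyOneLine? : ∀ P {Q : Line → Set} → (∀ l → Dec (Q l)) → Dec (ExactlyOneLine P Q)
exactlyOneLine? P {Q} Q? =
  map′ fromAny toAny (any? (λ l → Q? l ×-dec All.all? (λ m → Q? m →-dec (m ≟ₗ l)) P) P)
  where
  OnlyLine : Line → Set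
  OnlyLine l = Q l × All (λ m → Q m → m ≡ l) P

  fromAny : Any OnlyLine P → ExactlyOneLine P Q
  fromAny h with find h
  ... | l , l∈P , q , unique = l , l∈P , q , λ m m∈P → All.lookup unique m∈P

  toAny : ExactlyOneLine P Q → Any OnlyLine P
  toAny (l , l∈P , q , unique) = lose l∈P (q , All.tabulate (unique _))

collinear? : ∀ P x y z → Dec (Collinear P x y z)
collinear? P x y z = map′ find (λ (l , l∈P , h) → lose l∈P h)
  (any? (λ l → x ∈? l ×-dec y ∈? l ×-dec z ∈? l) P)

isAffinePlane? : ∀ P → Dec (IsAffinePlane P)
isAffinePlane? P =
  map′ (λ (j , p , n) → record { joining = j ; parallel = p ; nondegenerate = n })
       (λ A → IsAffinePlane.joining A , IsAffinePlane.parallel A , IsAffinePlane.nondegenerate A)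
       (  (allFin? λ x → allFin? λ y → ¬? (x ≟ y) →-dec
             exactlyOneLine? P (λ l → x ∈? l ×-dec y ∈? l))
   ×-dec (allLines? P λ l → allFin? λ p → ¬? (p ∈? l) →-dec
             exactlyOneLine? P (λ m → p ∈? m ×-dec (m ∩ l ≟ₗ ⊥)))
   ×-dec (anyFin? λ x → anyFin? λ y → anyFin? λ z → ¬? (collinear? P x y z)))

isAffinePlaneOfOrder3? : ∀ P → Dec (IsAffinePlaneOfOrder3 P)
isAffinePlaneOfOrder3? P =
  map′ (λ (A , s) → record { isAffinePlane = A ; lineSize = s })
       (λ A → IsAffinePlaneOfOrder3.isAffinePlane A , IsAffinePlaneOfOrder3.lineSize A)
       (isAffinePlane? P ×-dec allLines? P (λ l → ∣ l ∣ ≟ℕ 3))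

orthogoval? : ∀ P Q → Dec (Orthogoval P Q)
orthogoval? P Q = map′ (λ h l m l∈P m∈Q → h l l∈P m m∈Q) (λ h l l∈P m m∈Q → h l m l∈P m∈Q)
  (allLines? P λ l → allLines? Q λ m → ∣ l ∩ m ∣ ≤? 2)

line : (a b c : ℕ) {a<9 : True (a <? 9)} {b<9 : True (b <? 9)} {c<9 : True (c <? 9)} → Line
line a b c {a<9} {b<9} {c<9} = ⁅ (# a) {_} {a<9} ⁆ ∪ ⁅ (# b) {_} {b<9} ⁆ ∪ ⁅ (# c) {_} {c<9} ⁆

-- As the bound forces, the line of plane i through 0 and 1 is {0, 1, 2 + i}.
planes : Vec Plane 7
planes =
    (line 0 1 2 ∷ line 0 3 7 ∷ line 0 4 8 ∷ line 0 5 6 ∷ line 1 3 8 ∷ line 1 4 6 ∷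
     line 1 5 7 ∷ line 2 3 6 ∷ line 2 4 7 ∷ line 2 5 8 ∷ line 3 4 5 ∷ line 6 7 8 ∷ [])
  ∷ (line 0 1 3 ∷ line 0 2 8 ∷ line 0 4 5 ∷ line 0 6 7 ∷ line 1 2 7 ∷ line 1 4 8 ∷
     line 1 5 6 ∷ line 2 3 5 ∷ line 2 4 6 ∷ line 3 4 7 ∷ line 3 6 8 ∷ line 5 7 8 ∷ [])
  ∷ (line 0 1 4 ∷ line 0 2 3 ∷ line 0 5 7 ∷ line 0 6 8 ∷ line 1 2 6 ∷ line 1 3 7 ∷
     line 1 5 8 ∷ line 2 4 5 ∷ line 2 7 8 ∷ line 3 4 8 ∷ line 3 5 6 ∷ line 4 6 7 ∷ [])
  ∷ (line 0 1 5 ∷ line 0 2 4 ∷ line 0 3 6 ∷ line 0 7 8 ∷ line 1 2 8 ∷ line 1 3 4 ∷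
     line 1 6 7 ∷ line 2 3 7 ∷ line 2 5 6 ∷ line 3 5 8 ∷ line 4 5 7 ∷ line 4 6 8 ∷ [])
  ∷ (line 0 1 6 ∷ line 0 2 5 ∷ line 0 3 8 ∷ line 0 4 7 ∷ line 1 2 3 ∷ line 1 4 5 ∷
     line 1 7 8 ∷ line 2 4 8 ∷ line 2 6 7 ∷ line 3 4 6 ∷ line 3 5 7 ∷ line 5 6 8 ∷ [])
  ∷ (line 0 1 7 ∷ line 0 2 6 ∷ line 0 3 4 ∷ line 0 5 8 ∷ line 1 2 4 ∷ line 1 3 5 ∷
     line 1 6 8 ∷ line 2 3 8 ∷ line 2 5 7 ∷ line 3 6 7 ∷ line 4 5 6 ∷ line 4 7 8 ∷ [])
  ∷ (line 0 1 8 ∷ line 0 2 7 ∷ line 0 3 5 ∷ line 0 4 6 ∷ line 1 2 5 ∷ line 1 3 6 ∷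
     line 1 4 7 ∷ line 2 3 4 ∷ line 2 6 8 ∷ line 3 7 8 ∷ line 4 5 8 ∷ line 5 6 7 ∷ [])
  ∷ []

moap3-planes : MutuallyOrthogovalAffine3 7 (lookup planes)
moap3-planes =
  from-yes (allFin? λ i → isAffinePlaneOfOrder3? (lookup planes i)) ,
  from-yes (allFin? λ i → allFin? λ j → ¬? (i ≟ j) →-dec orthogoval? (lookup planes i) (lookup planes j))

theorem3p1 : HasMOAP3 7 × (∀ (k : ℕ) → HasMOAP3 k → k ≤ 7)
theorem3p1 = (lookup planes , moap3-planes) , moap3≤7
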